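{- Let $p$ be an odd prime and let $T$ be the tree $S_{(p-1)/2,2}$ with root $r$, children $u_0,\ldots,u_{(p-1)/2-1}$ of $r$, and $v_i$ the unique child of $u_i$. Let $\alpha$ be a primitive element of $\mathrm{GF}(p)$, let $S$ be the set of nonzero squares and $N$ the set of nonsquares of $\mathrm{GF}(p)$, and identify $\mathrm{GF}(p)$ with $\{0,\ldots,p-1\}$. (i) If $\alpha-1\in S$, then the labelling $b(r)=0$, $b(u_i)=\alpha^{2i+1}$, $b(v_i)=\alpha^{2i}$ is an oriented $\beta$-valuation of the orientation of $T$ with arcs $(r,u_i)$ and $(v_i,u_i)$ for $0\le i\le (p-1)/2-1$. (ii) If $\alpha-1\in N$, then the labelling $b(r)=0$, $b(u_i)=\alpha^{2i}$, $b(v_i)=\alpha^{2i+1}$ is an oriented $\beta$-valuation of the orientation of $T$ with arcs $(r,u_i)$ and $(u_i,v_i)$ for $0\le i\le (p-1)/2-1$.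
   Context: $S_{k,2}$ denotes the tree obtained from the star $K_{1,k}$ by replacing each edge by a path of length $2$. For a digraph with $n$ arcs, an oriented $\beta$-valuation is an injective map $b:V\to\{0,\ldots,n\}$ such that the multiset $\{b(v)-b(u)\bmod (n+1):(u,v)\text{ an arc}\}$ equals $\mathbb{Z}_{n+1}\setminus\{0\}$; here $n=p-1$, so differences are taken modulo $p$. -}

module Defs where

open import Data.Nat using (ℕ; zero; suc; _+_; _*_; _∸_; _^_; _≤_; _<_; NonZero)
open import Data.Nat.DivMod using (_%_)
open import Data.Fin using (Fin)
open import Data.List using (List; []; _∷_; map; length; concatMap; allFin; upTo)
open import Data.Product using (_×_; _,_; ∃; Σ)
open import Relation.Binary.PropositionalEquality using (_≡_; _≢_)
open import Relation.Nullary using (¬_)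
open import Function.Definitions using (Injective)
open import Data.List.Relation.Binary.Permutation.Propositional using (_↭_)

-- A finite digraph: a vertex type and a list of arcs (u , v) meaning u → v.
record Digraph : Set₁ where
  field
    Vertex : Set
    arcs   : List (Vertex × Vertex)
open Digraph public

oneTo : ℕ → List ℕ
oneTo n = map suc (upTo n)

-- Oriented β-valuation of a digraph D with n arcs: injective b : V → {0,…,n}
-- whose multiset of arc differences b(v) - b(u) mod (n+1) is Z_{n+1} \ {0}.
IsOrientedBetaValuation : (D : Digraph) → (Vertex D → ℕ) → Set
IsOrientedBetaValuation D b =
  (∀ x → b x ≤ n)
  × Injective _≡_ _≡_ b
  × (map (λ a → diff a) (arcs D) ↭ oneTo n)
  where
    n : ℕ
    n = length (arcs D)
    diff : Vertex D × Vertex D → ℕ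
    diff (x , y) = (b y + suc n ∸ b x) % suc n

-- Vertices of S_{k,2}: root r, children u_i of r, v_i the child of u_i.
data SVertex (k : ℕ) : Set where
  r : SVertex k
  u : Fin k → SVertex k
  v : Fin k → SVertex k

T-in : ℕ → Digraph
T-in k = record { Vertex = SVertex k
                ; arcs = concatMap (λ i → (r , u i) ∷ (v i , u i) ∷ []) (allFin k) }

T-out : ℕ → Digraph
T-out k = record { Vertex = SVertex k
                 ; arcs = concatMap (λ i → (r , u i) ∷ (u i , v i) ∷ []) (allFin k) }

-- GF(p) identified with {0,…,p-1}; arithmetic via ℕ mod p.
-- α is a primitive element of GF(p): α < p, α ≢ 0 mod p, and α has
-- multiplicative order exactly p-1.
IsPrimitiveElement : (p : ℕ) → .{{NonZero p}} → ℕ → Set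
IsPrimitiveElement p α =
  α < p × α % p ≢ 0 × (∀ j → 1 ≤ j → j < p ∸ 1 → (α ^ j) % p ≢ 1)

IsNonzeroSquare : (p : ℕ) → .{{NonZero p}} → ℕ → Set
IsNonzeroSquare p x = x % p ≢ 0 × ∃ λ y → (y * y) % p ≡ x % p

IsNonsquare : (p : ℕ) → .{{NonZero p}} → ℕ → Set
IsNonsquare p x = x % p ≢ 0 × ¬ (∃ λ y → (y * y) % p ≡ x % p)

label-i : (p : ℕ) → .{{NonZero p}} → ℕ → (k : ℕ) → SVertex k → ℕ
label-i p α k r = 0
label-i p α k (u i) = (α ^ (2 * Data.Fin.toℕ i + 1)) % p
label-i p α k (v i) = (α ^ (2 * Data.Fin.toℕ i)) % p

label-ii : (p : ℕ) → .{{NonZero p}} → ℕ → (k : ℕ) → SVertex k → ℕ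
label-ii p α k r = 0
label-ii p α k (u i) = (α ^ (2 * Data.Fin.toℕ i)) % p
label-ii p α k (v i) = (α ^ (2 * Data.Fin.toℕ i + 1)) % p

{-# OPTIONS --safe #-}
module Submission where

-- Both labellings put the same difference α^(2i+1) − α^(2i) = α^(2i)(α − 1) on the arc joining u_i and v_i,
-- while the root arcs carry the odd powers α^(2i+1) in (i) and the even powers α^(2i) in (ii). Writing
-- α − 1 = α^m, the differences thus form the coset α^s·S (s = 1, resp. 0) of the group S = {α^(2i)} of
-- nonzero squares together with the coset α^m·S. Since α^a ≡ α^b (mod p) forces a ≡ b (mod p − 1), the
-- parity of m is well defined, and it is even exactly when α − 1 is a square; so in both cases the two
-- cosets are complementary. A duplicate-free list of p − 1 nonzero residues is a rearrangement of 1, …, p − 1.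

open import Data.Empty using (⊥-elim)
open import Data.Fin using (Fin; toℕ)
open import Data.Fin.Properties using (toℕ-injective; toℕ<n)
open import Data.List using (List; []; _∷_; _++_; map; length; concatMap; allFin; upTo; applyUpTo)
open import Data.List.Properties using (length-map; length-++; length-upTo; length-applyUpTo; length-tabulate; map-cong)
open import Data.List.Membership.Propositional using (_∈_)
open import Data.List.Membership.Propositional.Properties using (∈-∃++; ∈-map⁺; ∈-map⁻; ∈-++⁻; ∈-upTo⁺; ∈-applyUpTo⁻)
open import Data.List.Relation.Binary.Disjoint.Propositional using (Disjoint)
open import Data.List.Relation.Binary.Permutation.Propositional using (_↭_; ↭-refl; ↭-sym; ↭-trans; prep)
open import Data.List.Relation.Binary.Permutation.Propositional.Properties using (shift; ↭-length; ∈-resp-↭)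
open import Data.List.Relation.Binary.Subset.Propositional using (_⊆_)
open import Data.List.Relation.Unary.Any using (here; there)
open import Data.List.Relation.Unary.Unique.Propositional using (Unique; _∷_)
open import Data.List.Relation.Unary.Unique.Propositional.Properties using (Unique[x∷xs]⇒x∉xs; ++⁺; map⁺; applyUpTo⁺₁; allFin⁺)
open import Data.Nat using (ℕ; zero; suc; _+_; _*_; _∸_; _^_; _/_; _%_; _≤_; _<_; z≤n; s≤s; s≤s⁻¹; z<s; NonZero; ≢-nonZero⁻¹; >-nonZero⁻¹)
open import Data.Nat.DivMod
open import Data.Nat.Divisibility using (_∣_; divides; ∣-trans; ∣1⇒≡1; m%n≡0⇒n∣m; n∣m⇒m%n≡0; m∣m*n)
open import Data.Nat.Primality using (Prime; euclidsLemma)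
open import Data.Nat.Properties
open import Data.Product using (_×_; _,_; ∃; proj₁; proj₂)
open import Data.Sum using (inj₁; inj₂)
open import Function.Base using (_∘_)
open import Function.Definitions using (Injective)
open import Relation.Binary.Definitions using (tri<; tri≈; tri>)
open import Relation.Binary.PropositionalEquality
open import Relation.Nullary using (¬_; contradiction)

open import Defs

module _ {a} {A : Set a} where

  unique-⊆-length⇒↭ : ∀ {xs ys : List A} → Unique xs → xs ⊆ ys → length ys ≤ length xs → xs ↭ ys
  unique-⊆-length⇒↭ {[]} {[]} _ _ _ = ↭-refl
  unique-⊆-length⇒↭ {x ∷ xs} {ys} x∷xs!@(_ ∷ xs!) x∷xs⊆ys |ys|≤
    with ys₁ , ys₂ , refl ← ∈-∃++ (x∷xs⊆ys (here refl)) =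
    ↭-trans (prep x (unique-⊆-length⇒↭ xs! xs⊆ys₁++ys₂ |ys₁++ys₂|≤)) (↭-sym (shift x ys₁ ys₂))
    where
      xs⊆ys₁++ys₂ : xs ⊆ ys₁ ++ ys₂
      xs⊆ys₁++ys₂ y∈xs with ∈-resp-↭ (shift x ys₁ ys₂) (x∷xs⊆ys (there y∈xs))
      ... | here refl = contradiction y∈xs (Unique[x∷xs]⇒x∉xs x∷xs!)
      ... | there y∈ys₁++ys₂ = y∈ys₁++ys₂
      |ys₁++ys₂|≤ : length (ys₁ ++ ys₂) ≤ length xs
      |ys₁++ys₂|≤ = s≤s⁻¹ (subst (_≤ suc (length xs)) (↭-length (shift x ys₁ ys₂)) |ys|≤)

  map-interleave↭ : ∀ {b i} {B : Set b} {I : Set i} (h : B → A) (f g : I → B) (is : List I) →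
    map h (concatMap (λ i → f i ∷ g i ∷ []) is) ↭ map (h ∘ f) is ++ map (h ∘ g) is
  map-interleave↭ h f g [] = ↭-refl
  map-interleave↭ h f g (i ∷ is) = prep (h (f i)) (↭-trans (prep (h (g i)) (map-interleave↭ h f g is))
    (↭-sym (shift (h (g i)) (map (h ∘ f) is) (map (h ∘ g) is))))

∈-oneTo⁺ : ∀ {n x} → x ≢ 0 → x ≤ n → x ∈ oneTo n
∈-oneTo⁺ {x = zero} x≢0 _ = contradiction refl x≢0
∈-oneTo⁺ {x = suc x} _ x<n = ∈-map⁺ suc (∈-upTo⁺ x<n)

length-oneTo : ∀ n → length (oneTo n) ≡ n
length-oneTo n = trans (length-map suc (upTo n)) (length-upTo n)

unique-⊆-oneTo⇒↭ : ∀ {n xs} → Unique xs → xs ⊆ oneTo n → length xs ≡ n → xs ↭ oneTo n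
unique-⊆-oneTo⇒↭ {n} xs! xs⊆ |xs|≡n = unique-⊆-length⇒↭ xs! xs⊆ (≤-reflexive (trans (length-oneTo n) (sym |xs|≡n)))

arcDifference : ∀ {V : Set} → ℕ → (V → ℕ) → V × V → ℕ
arcDifference n b (x , y) = (b y + suc n ∸ b x) % suc n

isOrientedBetaValuation : ∀ (D : Digraph) (b : Vertex D → ℕ) {n} → (∀ x → b x ≤ n) → Injective _≡_ _≡_ b →
  map (arcDifference n b) (arcs D) ↭ oneTo n → IsOrientedBetaValuation D b
isOrientedBetaValuation D b {n} bounded injective differences =
  subst (λ m → (∀ x → b x ≤ m) × Injective _≡_ _≡_ b × (map (arcDifference m b) (arcs D) ↭ oneTo m))
    (sym |arcs|≡n) (bounded , injective , differences)
  where
    |arcs|≡n : length (arcs D) ≡ n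
    |arcs|≡n = trans (sym (length-map (arcDifference n b) (arcs D))) (trans (↭-length differences) (length-oneTo n))

module _ {m : ℕ} .{{_ : NonZero m}} where

  %≡%⇒∣∸ : ∀ {a b} → a % m ≡ b % m → m ∣ b ∸ a
  %≡%⇒∣∸ {a} {b} a≡b = divides (b / m ∸ a / m) (begin
    b ∸ a                                     ≡⟨ cong₂ _∸_ (m≡m%n+[m/n]*n b m) (m≡m%n+[m/n]*n a m) ⟩
    (b % m + b / m * m) ∸ (a % m + a / m * m) ≡⟨ cong (λ r → (b % m + b / m * m) ∸ (r + a / m * m)) a≡b ⟩
    (b % m + b / m * m) ∸ (b % m + a / m * m) ≡⟨ [m+n]∸[m+o]≡n∸o (b % m) _ _ ⟩
    b / m * m ∸ a / m * m                     ≡⟨ *-distribʳ-∸ m (b / m) (a / m) ⟨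
    (b / m ∸ a / m) * m                       ∎)
    where open ≡-Reasoning

  ≤∧∣∸⇒%≡% : ∀ {a b} → a ≤ b → m ∣ b ∸ a → a % m ≡ b % m
  ≤∧∣∸⇒%≡% {a} a≤b m∣b∸a = trans (sym (%-remove-+ʳ a m∣b∸a)) (cong (_% m) (m+[n∸m]≡n a≤b))

  ∣∸⇒%≡% : ∀ {a b} → m ∣ b ∸ a → m ∣ a ∸ b → a % m ≡ b % m
  ∣∸⇒%≡% {a} {b} m∣b∸a m∣a∸b with ≤-total a b
  ... | inj₁ a≤b = ≤∧∣∸⇒%≡% a≤b m∣b∸a
  ... | inj₂ b≤a = sym (≤∧∣∸⇒%≡% b≤a m∣a∸b)

  +-cancelʳ-% : ∀ c {a b} → (a + c) % m ≡ (b + c) % m → a % m ≡ b % m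
  +-cancelʳ-% c {a} {b} a+c≡b+c = ∣∸⇒%≡% (m∣∸ a+c≡b+c) (m∣∸ (sym a+c≡b+c))
    where
      m∣∸ : ∀ {a b} → (a + c) % m ≡ (b + c) % m → m ∣ b ∸ a
      m∣∸ {a} {b} eq = subst (m ∣_) (trans (cong₂ _∸_ (+-comm b c) (+-comm a c)) ([m+n]∸[m+o]≡n∸o c b a))
        (%≡%⇒∣∸ eq)

  +-cong-% : ∀ {a b c d} → a % m ≡ b % m → c % m ≡ d % m → (a + c) % m ≡ (b + d) % m
  +-cong-% {a} {b} {c} {d} a≡b c≡d = begin
    (a + c) % m           ≡⟨ %-distribˡ-+ a c m ⟩
    (a % m + c % m) % m   ≡⟨ cong₂ (λ x y → (x + y) % m) a≡b c≡d ⟩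
    (b % m + d % m) % m   ≡⟨ %-distribˡ-+ b d m ⟨
    (b + d) % m           ∎
    where open ≡-Reasoning

  *-cong-% : ∀ {a b c d} → a % m ≡ b % m → c % m ≡ d % m → (a * c) % m ≡ (b * d) % m
  *-cong-% {a} {b} {c} {d} a≡b c≡d = begin
    (a * c) % m           ≡⟨ %-distribˡ-* a c m ⟩
    (a % m * (c % m)) % m ≡⟨ cong₂ (λ x y → (x * y) % m) a≡b c≡d ⟩
    (b % m * (d % m)) % m ≡⟨ %-distribˡ-* b d m ⟨
    (b * d) % m           ∎
    where open ≡-Reasoning

  *-congˡ-% : ∀ a {c d} → c % m ≡ d % m → (a * c) % m ≡ (a * d) % m
  *-congˡ-% a = *-cong-% {a} {a} refl

  ^-cong-% : ∀ {a b} e → a % m ≡ b % m → (a ^ e) % m ≡ (b ^ e) % m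
  ^-cong-% zero    _   = refl
  ^-cong-% (suc e) a≡b = *-cong-% a≡b (^-cong-% e a≡b)

  -- Subtraction in ℤ/m in the form used by arc differences: adding m first keeps ∸ from truncating.
  [a+m∸b%m]%m≡x%m : ∀ {a b x} → (x + b) % m ≡ a % m → (a + m ∸ b % m) % m ≡ x % m
  [a+m∸b%m]%m≡x%m {a} {b} {x} x+b≡a = +-cancelʳ-% (b % m) (begin
    (a + m ∸ b % m + b % m) % m ≡⟨ cong (_% m) (m∸n+n≡m (≤-trans (m%n≤n b m) (m≤n+m m a))) ⟩
    (a + m) % m                 ≡⟨ [m+n]%n≡m%n a m ⟩
    a % m                       ≡⟨ x+b≡a ⟨
    (x + b) % m                 ≡⟨ +-cong-% {x} refl (m%n%n≡m%n b m) ⟨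
    (x + b % m) % m             ∎)
    where open ≡-Reasoning

module _ {p : ℕ} .{{_ : NonZero p}} (p-prime : Prime p) where

  ∤*∤⇒∤ : ∀ {a b} → ¬ p ∣ a → ¬ p ∣ b → ¬ p ∣ a * b
  ∤*∤⇒∤ {a} {b} p∤a p∤b p∣ab with euclidsLemma a b p-prime p∣ab
  ... | inj₁ p∣a = p∤a p∣a
  ... | inj₂ p∣b = p∤b p∣b

  *-cancelˡ-% : ∀ x {a b} → ¬ p ∣ x → (x * a) % p ≡ (x * b) % p → a % p ≡ b % p
  *-cancelˡ-% x p∤x xa≡xb = ∣∸⇒%≡% (p∣∸ xa≡xb) (p∣∸ (sym xa≡xb))
    where
      p∣∸ : ∀ {a b} → (x * a) % p ≡ (x * b) % p → p ∣ b ∸ a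
      p∣∸ {a} {b} eq with euclidsLemma x (b ∸ a) p-prime (subst (p ∣_) (sym (*-distribˡ-∸ x b a)) (%≡%⇒∣∸ eq))
      ... | inj₁ p∣x   = contradiction p∣x p∤x
      ... | inj₂ p∣b∸a = p∣b∸a

spider : (k : ℕ) → (Fin k → SVertex k × SVertex k) → Digraph
spider k outer = record { Vertex = SVertex k ; arcs = concatMap (λ i → (r , u i) ∷ outer i ∷ []) (allFin k) }

module PrimitiveRoot (n : ℕ) .{{_ : NonZero n}} (p-prime : Prime (suc n))
                     (α : ℕ) (α-primitive : IsPrimitiveElement (suc n) α) where

  open ≡-Reasoning

  p : ℕ
  p = suc n

  pow : ℕ → ℕ
  pow e = α ^ e % p

  p∤α^ : ∀ e → ¬ p ∣ α ^ e
  p∤α^ zero    p∣1 = ≢-nonZero⁻¹ n (suc-injective (∣1⇒≡1 p∣1))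
  p∤α^ (suc e) = ∤*∤⇒∤ p-prime p∤α (p∤α^ e)
    where
      p∤α : ¬ p ∣ α
      p∤α p∣α = proj₁ (proj₂ α-primitive) (n∣m⇒m%n≡0 α p p∣α)

  pow≢0 : ∀ e → pow e ≢ 0
  pow≢0 e = p∤α^ e ∘ m%n≡0⇒n∣m (α ^ e) p

  %p∈oneTo : ∀ {x} → ¬ p ∣ x → x % p ∈ oneTo n
  %p∈oneTo {x} p∤x = ∈-oneTo⁺ (p∤x ∘ m%n≡0⇒n∣m x p) (s≤s⁻¹ (m%n<n x p))

  pow≤n : ∀ e → pow e ≤ n
  pow≤n e = s≤s⁻¹ (m%n<n (α ^ e) p)

  pow∈oneTo : ∀ e → pow e ∈ oneTo n
  pow∈oneTo e = %p∈oneTo (p∤α^ e)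

  pow≢1 : ∀ {j} → 0 < j → j < n → pow j ≢ pow 0
  pow≢1 {j} 0<j j<n αʲ≡1 =
    proj₂ (proj₂ α-primitive) j 0<j j<n (trans αʲ≡1 (m<n⇒m%n≡m (s≤s (>-nonZero⁻¹ n))))

  pow-cancel : ∀ {a b} → a ≤ b → pow a ≡ pow b → pow (b ∸ a) ≡ pow 0
  pow-cancel {a} {b} a≤b αᵃ≡αᵇ = *-cancelˡ-% p-prime (α ^ a) (p∤α^ a) (begin
    (α ^ a * α ^ (b ∸ a)) % p ≡⟨ cong (_% p) (^-distribˡ-+-* α a (b ∸ a)) ⟨
    pow (a + (b ∸ a))         ≡⟨ cong pow (m+[n∸m]≡n a≤b) ⟩
    pow b                     ≡⟨ αᵃ≡αᵇ ⟨
    pow a                     ≡⟨ cong (_% p) (*-identityʳ (α ^ a)) ⟨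
    (α ^ a * 1) % p           ∎)

  pow-distinct : ∀ {a b} → a < b → b < n → pow a ≢ pow b
  pow-distinct {a} {b} a<b b<n αᵃ≡αᵇ =
    pow≢1 (m<n⇒0<n∸m a<b) (≤-<-trans (m∸n≤m b a) b<n) (pow-cancel (<⇒≤ a<b) αᵃ≡αᵇ)

  pow-injective-below : ∀ {a b} → a < n → b < n → pow a ≡ pow b → a ≡ b
  pow-injective-below {a} {b} a<n b<n αᵃ≡αᵇ with <-cmp a b
  ... | tri< a<b _ _ = contradiction αᵃ≡αᵇ (pow-distinct a<b b<n)
  ... | tri≈ _ a≡b _ = a≡b
  ... | tri> _ _ b<a = contradiction (sym αᵃ≡αᵇ) (pow-distinct b<a a<n)

  powers↭oneTo : applyUpTo pow n ↭ oneTo n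
  powers↭oneTo = unique-⊆-oneTo⇒↭ (applyUpTo⁺₁ pow n pow-distinct) powers⊆oneTo (length-applyUpTo pow n)
    where
      powers⊆oneTo : applyUpTo pow n ⊆ oneTo n
      powers⊆oneTo v∈ with e , _ , refl ← ∈-applyUpTo⁻ pow v∈ = pow∈oneTo e

  discrete-log : ∀ {x} → ¬ p ∣ x → ∃ λ e → e < n × pow e ≡ x % p
  discrete-log {x} p∤x with e , e<n , x≡αᵉ ← ∈-applyUpTo⁻ pow (∈-resp-↭ (↭-sym powers↭oneTo) (%p∈oneTo p∤x)) =
    e , e<n , sym x≡αᵉ

  fermat : pow n ≡ pow 0
  fermat with discrete-log (p∤α^ n)
  ... | zero  , _   , α⁰≡αⁿ = sym α⁰≡αⁿ
  ... | suc e , e<n , αᵉ≡αⁿ =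
    contradiction (pow-cancel (<⇒≤ e<n) αᵉ≡αⁿ) (pow≢1 (m<n⇒0<n∸m e<n) (∸-monoʳ-< z<s (<⇒≤ e<n)))

  pow-%n : ∀ d → pow d ≡ pow (d % n)
  pow-%n d = begin
    pow d                                   ≡⟨ cong pow (m≡m%n+[m/n]*n d n) ⟩
    pow (d % n + d / n * n)                 ≡⟨ cong (_% p) (^-distribˡ-+-* α (d % n) (d / n * n)) ⟩
    (α ^ (d % n) * α ^ (d / n * n)) % p     ≡⟨ *-congˡ-% (α ^ (d % n)) αⁿ^q≡1 ⟩
    (α ^ (d % n) * 1) % p                   ≡⟨ cong (_% p) (*-identityʳ (α ^ (d % n))) ⟩
    pow (d % n)                             ∎
    where
      αⁿ^q≡1 : pow (d / n * n) ≡ 1 % p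
      αⁿ^q≡1 = begin
        pow (d / n * n)      ≡⟨ cong pow (*-comm (d / n) n) ⟩
        pow (n * (d / n))    ≡⟨ cong (_% p) (^-*-assoc α n (d / n)) ⟨
        (α ^ n) ^ (d / n) % p ≡⟨ ^-cong-% (d / n) fermat ⟩
        1 ^ (d / n) % p      ≡⟨ cong (_% p) (^-zeroˡ (d / n)) ⟩
        1 % p                ∎

  pow-injective-% : ∀ a b → pow a ≡ pow b → a % n ≡ b % n
  pow-injective-% a b αᵃ≡αᵇ =
    pow-injective-below (m%n<n a n) (m%n<n b n) (trans (sym (pow-%n a)) (trans αᵃ≡αᵇ (pow-%n b)))

  pow-double : ∀ t → pow (t * 2) ≡ (α ^ t * α ^ t) % p
  pow-double t = cong (_% p) (trans (sym (^-*-assoc α t 2)) (cong (α ^ t *_) (*-identityʳ (α ^ t))))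

  square⇒even-log : ∀ c → c % p ≢ 0 → (∃ λ y → (y * y) % p ≡ c % p) → ∃ λ t → pow (t * 2) ≡ c % p
  square⇒even-log c c≢0 (y , y²≡c) = let t , _ , αᵗ≡y = discrete-log p∤y in t , (begin
    pow (t * 2)         ≡⟨ pow-double t ⟩
    (α ^ t * α ^ t) % p ≡⟨ *-cong-% {a = α ^ t} {b = y} {c = α ^ t} {d = y} αᵗ≡y αᵗ≡y ⟩
    (y * y) % p         ≡⟨ y²≡c ⟩
    c % p               ∎)
    where
      p∤y : ¬ p ∣ y
      p∤y p∣y = c≢0 (trans (sym y²≡c) (n∣m⇒m%n≡0 (y * y) p (∣-trans p∣y (m∣m*n y))))

  even-log⇒square : ∀ c m → pow m ≡ c % p → m % 2 ≡ 0 → ∃ λ y → (y * y) % p ≡ c % p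
  even-log⇒square c m αᵐ≡c m-even = α ^ (m / 2) , (begin
    (α ^ (m / 2) * α ^ (m / 2)) % p ≡⟨ pow-double (m / 2) ⟨
    pow (m / 2 * 2)                 ≡⟨ cong pow (m/n*n≡m (m%n≡0⇒n∣m m 2 m-even)) ⟩
    pow m                           ≡⟨ αᵐ≡c ⟩
    c % p                           ∎)

  pow-step : ∀ e → (pow (e + 1) + p ∸ pow e) % p ≡ (α ^ e * (α + p ∸ 1)) % p
  pow-step e = [a+m∸b%m]%m≡x%m {a = pow (e + 1)} {b = α ^ e} {x = α ^ e * (α + p ∸ 1)} (begin
    (α ^ e * (α + p ∸ 1) + α ^ e) % p     ≡⟨ cong (λ z → (α ^ e * (α + p ∸ 1) + z) % p) (*-identityʳ (α ^ e)) ⟨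
    (α ^ e * (α + p ∸ 1) + α ^ e * 1) % p ≡⟨ cong (_% p) (*-distribˡ-+ (α ^ e) (α + p ∸ 1) 1) ⟨
    (α ^ e * (α + p ∸ 1 + 1)) % p         ≡⟨ cong (λ z → (α ^ e * z) % p) (m∸n+n≡m (≤-trans (s≤s z≤n) (m≤n+m p α))) ⟩
    (α ^ e * (α + p)) % p                 ≡⟨ *-congˡ-% (α ^ e) ([m+n]%n≡m%n α p) ⟩
    (α ^ e * α) % p                       ≡⟨ cong (λ z → (α ^ e * z) % p) (^-identityʳ α) ⟨
    (α ^ e * α ^ 1) % p                   ≡⟨ cong (_% p) (^-distribˡ-+-* α e 1) ⟨
    pow (e + 1)                           ≡⟨ m%n%n≡m%n (α ^ (e + 1)) p ⟨
    pow (e + 1) % p                       ∎)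

  pow-step-log : ∀ m → pow m ≡ (α + p ∸ 1) % p → ∀ e → (pow (e + 1) + p ∸ pow e) % p ≡ pow (e + m)
  pow-step-log m αᵐ≡α-1 e = begin
    (pow (e + 1) + p ∸ pow e) % p ≡⟨ pow-step e ⟩
    (α ^ e * (α + p ∸ 1)) % p     ≡⟨ *-congˡ-% (α ^ e) (sym αᵐ≡α-1) ⟩
    (α ^ e * α ^ m) % p           ≡⟨ cong (_% p) (^-distribˡ-+-* α e m) ⟨
    pow (e + m)                   ∎

  module Spider (k : ℕ) (2k≡n : 2 * k ≡ n) where

    pow-parity : ∀ a b → pow a ≡ pow b → a % 2 ≡ b % 2
    pow-parity a b αᵃ≡αᵇ = begin
      a % 2     ≡⟨ m∣n⇒o%n%m≡o%m 2 n a 2∣n ⟨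
      a % n % 2 ≡⟨ cong (_% 2) (pow-injective-% a b αᵃ≡αᵇ) ⟩
      b % n % 2 ≡⟨ m∣n⇒o%n%m≡o%m 2 n b 2∣n ⟩
      b % 2     ∎
      where
        2∣n : 2 ∣ n
        2∣n = divides k (trans (sym 2k≡n) (*-comm 2 k))

    coset-injective : ∀ s {i j : Fin k} → pow (2 * toℕ i + s) ≡ pow (2 * toℕ j + s) → i ≡ j
    coset-injective s {i} {j} eq = toℕ-injective (*-cancelˡ-≡ (toℕ i) (toℕ j) 2 (begin
      2 * toℕ i     ≡⟨ m<n⇒m%n≡m (2i<n i) ⟨
      2 * toℕ i % n ≡⟨ +-cancelʳ-% s {2 * toℕ i} {2 * toℕ j} (pow-injective-% (2 * toℕ i + s) (2 * toℕ j + s) eq) ⟩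
      2 * toℕ j % n ≡⟨ m<n⇒m%n≡m (2i<n j) ⟩
      2 * toℕ j     ∎))
      where
        2i<n : ∀ (i : Fin k) → 2 * toℕ i < n
        2i<n i = subst (2 * toℕ i <_) 2k≡n (*-monoʳ-< 2 (toℕ<n i))

    cosets-apart : ∀ {s t} → s % 2 ≢ t % 2 → ∀ (i j : Fin k) → pow (2 * toℕ i + s) ≢ pow (2 * toℕ j + t)
    cosets-apart {s} {t} s≢t i j eq = s≢t (begin
      s % 2               ≡⟨ %-remove-+ˡ {2 * toℕ i} s (m∣m*n (toℕ i)) ⟨
      (2 * toℕ i + s) % 2 ≡⟨ pow-parity (2 * toℕ i + s) (2 * toℕ j + t) eq ⟩
      (2 * toℕ j + t) % 2 ≡⟨ %-remove-+ˡ {2 * toℕ j} t (m∣m*n (toℕ j)) ⟩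
      t % 2               ∎)

    coset : ℕ → List ℕ
    coset s = map (λ i → pow (2 * toℕ i + s)) (allFin k)

    cosets↭oneTo : ∀ {s t} → s % 2 ≢ t % 2 → coset s ++ coset t ↭ oneTo n
    cosets↭oneTo {s} {t} s≢t = unique-⊆-oneTo⇒↭ (++⁺ (unique s) (unique t) disjoint) ⊆oneTo |cosets|≡n
      where
        unique : ∀ s → Unique (coset s)
        unique s = map⁺ (coset-injective s) (allFin⁺ k)
        disjoint : Disjoint (coset s) (coset t)
        disjoint (v∈s , v∈t) with i , _ , refl ← ∈-map⁻ _ v∈s | j , _ , eq ← ∈-map⁻ _ v∈t = cosets-apart s≢t i j eq
        ⊆oneTo : coset s ++ coset t ⊆ oneTo n
        ⊆oneTo v∈ with ∈-++⁻ (coset s) v∈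
        ... | inj₁ v∈s with i , _ , refl ← ∈-map⁻ _ v∈s = pow∈oneTo (2 * toℕ i + s)
        ... | inj₂ v∈t with j , _ , refl ← ∈-map⁻ _ v∈t = pow∈oneTo (2 * toℕ j + t)
        |cosets|≡n : length (coset s ++ coset t) ≡ n
        |cosets|≡n = begin
          length (coset s ++ coset t)         ≡⟨ length-++ (coset s) ⟩
          length (coset s) + length (coset t) ≡⟨ cong₂ _+_ (|coset| s) (|coset| t) ⟩
          k + k                               ≡⟨ cong (k +_) (+-identityʳ k) ⟨
          2 * k                               ≡⟨ 2k≡n ⟩
          n                                   ∎
          where
            |coset| : ∀ s → length (coset s) ≡ k
            |coset| s = trans (length-map _ (allFin k)) (length-tabulate _)

    labelling-injective : ∀ s t (b : SVertex k → ℕ) → s % 2 ≢ t % 2 → b r ≡ 0 →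
      (∀ i → b (u i) ≡ pow (2 * toℕ i + s)) → (∀ i → b (v i) ≡ pow (2 * toℕ i + t)) → Injective _≡_ _≡_ b
    labelling-injective s t b s≢t b-r b-u b-v = injective
      where
        injective : Injective _≡_ _≡_ b
        injective {r}   {r}   _  = refl
        injective {r}   {u j} eq = ⊥-elim (pow≢0 (2 * toℕ j + s) (trans (sym (b-u j)) (trans (sym eq) b-r)))
        injective {r}   {v j} eq = ⊥-elim (pow≢0 (2 * toℕ j + t) (trans (sym (b-v j)) (trans (sym eq) b-r)))
        injective {u i} {r}   eq = ⊥-elim (pow≢0 (2 * toℕ i + s) (trans (sym (b-u i)) (trans eq b-r)))
        injective {v i} {r}   eq = ⊥-elim (pow≢0 (2 * toℕ i + t) (trans (sym (b-v i)) (trans eq b-r)))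
        injective {u i} {u j} eq = cong u (coset-injective s (trans (sym (b-u i)) (trans eq (b-u j))))
        injective {v i} {v j} eq = cong v (coset-injective t (trans (sym (b-v i)) (trans eq (b-v j))))
        injective {u i} {v j} eq = ⊥-elim (cosets-apart s≢t i j (trans (sym (b-u i)) (trans eq (b-v j))))
        injective {v i} {u j} eq = ⊥-elim (cosets-apart s≢t j i (trans (sym (b-u j)) (trans (sym eq) (b-v i))))

    spider-valuation : ∀ s t m (b : SVertex k → ℕ) (outer : Fin k → SVertex k × SVertex k) →
      s % 2 ≢ t % 2 → s % 2 ≢ m % 2 →
      b r ≡ 0 → (∀ i → b (u i) ≡ pow (2 * toℕ i + s)) → (∀ i → b (v i) ≡ pow (2 * toℕ i + t)) →
      (∀ i → arcDifference n b (outer i) ≡ pow (2 * toℕ i + m)) →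
      IsOrientedBetaValuation (spider k outer) b
    spider-valuation s t m b outer s≢t s≢m b-r b-u b-v outer-difference =
      isOrientedBetaValuation (spider k outer) b bounded (labelling-injective s t b s≢t b-r b-u b-v) differences
      where
        bounded : ∀ x → b x ≤ n
        bounded r     = subst (_≤ n) (sym b-r) z≤n
        bounded (u i) = subst (_≤ n) (sym (b-u i)) (pow≤n (2 * toℕ i + s))
        bounded (v i) = subst (_≤ n) (sym (b-v i)) (pow≤n (2 * toℕ i + t))

        root-difference : ∀ i → arcDifference n b (r , u i) ≡ pow (2 * toℕ i + s)
        root-difference i = begin
          (b (u i) + p ∸ b r) % p       ≡⟨ cong₂ (λ x y → (x + p ∸ y) % p) (b-u i) b-r ⟩
          (pow (2 * toℕ i + s) + p) % p ≡⟨ [m+n]%n≡m%n (pow (2 * toℕ i + s)) p ⟩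
          pow (2 * toℕ i + s) % p       ≡⟨ m%n%n≡m%n (α ^ (2 * toℕ i + s)) p ⟩
          pow (2 * toℕ i + s)           ∎

        differences-are-cosets :
          map (arcDifference n b ∘ λ i → r , u i) (allFin k) ++ map (arcDifference n b ∘ outer) (allFin k)
            ≡ coset s ++ coset m
        differences-are-cosets =
          cong₂ _++_ (map-cong root-difference (allFin k)) (map-cong outer-difference (allFin k))

        differences : map (arcDifference n b) (arcs (spider k outer)) ↭ oneTo n
        differences = ↭-trans (map-interleave↭ (arcDifference n b) (λ i → r , u i) outer (allFin k))
          (subst (_↭ oneTo n) (sym differences-are-cosets) (cosets↭oneTo s≢m))

    square-case : IsNonzeroSquare p (α + p ∸ 1) → IsOrientedBetaValuation (T-in k) (label-i p α k)
    square-case (α-1≢0 , α-1-square) = from-log (square⇒even-log (α + p ∸ 1) α-1≢0 α-1-square)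
      where
        from-log : (∃ λ t → pow (t * 2) ≡ (α + p ∸ 1) % p) → IsOrientedBetaValuation (T-in k) (label-i p α k)
        from-log (t , α²ᵗ≡α-1) = spider-valuation 1 0 (t * 2) (label-i p α k) (λ i → v i , u i)
          (λ ()) (λ 1≡[t*2]%2 → 1+n≢0 (trans 1≡[t*2]%2 (m*n%n≡0 t 2)))
          refl (λ _ → refl) (λ i → cong pow (sym (+-identityʳ (2 * toℕ i))))
          (λ i → pow-step-log (t * 2) α²ᵗ≡α-1 (2 * toℕ i))

    nonsquare-case : IsNonsquare p (α + p ∸ 1) → IsOrientedBetaValuation (T-out k) (label-ii p α k)
    nonsquare-case (α-1≢0 , α-1-nonsquare) = from-log (discrete-log (α-1≢0 ∘ n∣m⇒m%n≡0 (α + p ∸ 1) p))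
      where
        from-log : (∃ λ m → m < n × pow m ≡ (α + p ∸ 1) % p) → IsOrientedBetaValuation (T-out k) (label-ii p α k)
        from-log (m , _ , αᵐ≡α-1) = spider-valuation 0 1 m (label-ii p α k) (λ i → u i , v i)
          (λ ()) (λ 0≡m%2 → α-1-nonsquare (even-log⇒square (α + p ∸ 1) m αᵐ≡α-1 (sym 0≡m%2)))
          refl (λ i → cong pow (sym (+-identityʳ (2 * toℕ i)))) (λ _ → refl)
          (λ i → pow-step-log m αᵐ≡α-1 (2 * toℕ i))

2∤1+n⇒2∣n : ∀ {n} → ¬ 2 ∣ suc n → 2 ∣ n
2∤1+n⇒2∣n {n} 2∤1+n with n % 2 | m≡m%n+[m/n]*n n 2 | m%n<n n 2
... | 0           | n≡[n/2]*2   | _ = divides (n / 2) n≡[n/2]*2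
... | 1           | n≡1+[n/2]*2 | _ = contradiction (divides (suc (n / 2)) (cong suc n≡1+[n/2]*2)) 2∤1+n
... | suc (suc _) | _           | s≤s (s≤s ())

proposition5p5 : (p : ℕ) → .{{_ : NonZero p}} → Prime p → ¬ (2 ∣ p) →
    (α : ℕ) → IsPrimitiveElement p α →
    (IsNonzeroSquare p (α + p ∸ 1) →
      IsOrientedBetaValuation (T-in ((p ∸ 1) / 2)) (label-i p α ((p ∸ 1) / 2)))
    × (IsNonsquare p (α + p ∸ 1) →
      IsOrientedBetaValuation (T-out ((p ∸ 1) / 2)) (label-ii p α ((p ∸ 1) / 2)))
proposition5p5 (suc zero) ()
proposition5p5 (suc (suc n)) p-prime p-odd α α-primitive = square-case , nonsquare-case
  where
    open PrimitiveRoot (suc n) p-prime α α-primitive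
    open Spider (suc n / 2) (m*[n/m]≡n (2∤1+n⇒2∣n p-odd))
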